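{- Let $G$ be a good graph (in particular bipartite with maximum degree at most three). If $X\subseteq V(G)$, then $G-X$ is good.
   Context: A leaf is a vertex of degree one; a support vertex is a vertex adjacent to a leaf. A graph $G$ is good if it is bipartite, has maximum degree at most three, and: (G1) no vertex of degree three is adjacent to three vertices of degree three; (G2) for every pair of adjacent vertices $x,y$ of degree three, either at least one of $x,y$ is adjacent to a leaf, or each of $x,y$ is adjacent to a support vertex of degree two; (G3) if $x,y,z$ are vertices of degree three such that $xyz$ is a path, each of $x$ and $z$ is adjacent to a leaf, and the neighbor $y'$ of $y$ other than $x,z$ has degree two, then the neighbor of $y'$ other than $y$ is a leaf; (G4) if $x,y,z$ are vertices of degree three such that $xyz$ is a path and $N(z)=\{z_1,z_2,y\}$ with $\deg(z_1)\ge2$ and $\deg(z_2)\ge 2$, then $z_1$ or $z_2$ is a support vertex of degree two. All degrees are taken in the graph under consideration. -}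

module Defs where

open import Data.Nat using (ℕ; _≤_)
open import Data.Bool using (Bool; true; false)
open import Data.Fin using (Fin)
open import Data.Fin.Subset using (Subset; _∈_; _∩_; _─_; ∣_∣)
open import Data.Vec using (tabulate)
open import Data.Product using (Σ; ∃; _×_)
open import Data.Sum using (_⊎_)
open import Relation.Nullary using (¬_)
open import Relation.Binary.PropositionalEquality using (_≡_; _≢_)

-- A finite simple graph whose vertex set V is a subset of Fin n;
-- E is a symmetric irreflexive adjacency relation on Fin n (only its
-- restriction to V matters).
record Graph (n : ℕ) : Set where
  field
    V      : Subset n
    E      : Fin n → Fin n → Bool
    E-sym  : ∀ x y → E x y ≡ E y x
    E-irr  : ∀ x → E x x ≡ false
open Graph public

module _ {n : ℕ} (G : Graph n) where

  Adj : Fin n → Fin n → Set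
  Adj x y = x ∈ V G × y ∈ V G × E G x y ≡ true

  N : Fin n → Subset n
  N x = V G ∩ tabulate (E G x)

  deg : Fin n → ℕ
  deg x = ∣ N x ∣

  Leaf : Fin n → Set
  Leaf x = x ∈ V G × deg x ≡ 1

  Support : Fin n → Set
  Support x = ∃ λ y → Adj x y × Leaf y

  Support2 : Fin n → Set
  Support2 x = deg x ≡ 2 × Support x

  Bipartite : Set
  Bipartite = Σ (Fin n → Bool) λ c → ∀ x y → Adj x y → c x ≢ c y

  MaxDeg≤3 : Set
  MaxDeg≤3 = ∀ x → x ∈ V G → deg x ≤ 3

  Deg3 : Fin n → Set
  Deg3 x = x ∈ V G × deg x ≡ 3

  G1 : Set
  G1 = ∀ x → Deg3 x → ¬ (Σ (Fin n) λ a → Σ (Fin n) λ b → Σ (Fin n) λ c →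
         a ≢ b × a ≢ c × b ≢ c ×
         Adj x a × Adj x b × Adj x c × Deg3 a × Deg3 b × Deg3 c)

  G2 : Set
  G2 = ∀ x y → Deg3 x → Deg3 y → Adj x y →
         (Support x ⊎ Support y)
         ⊎ ((∃ λ a → Adj x a × Support2 a) × (∃ λ b → Adj y b × Support2 b))

  G3 : Set
  G3 = ∀ x y z y' → Deg3 x → Deg3 y → Deg3 z →
         Adj x y → Adj y z → x ≢ z →
         Support x → Support z →
         Adj y y' → y' ≢ x → y' ≢ z → deg y' ≡ 2 →
         ∀ w → Adj y' w → w ≢ y → Leaf w

  G4 : Set
  G4 = ∀ x y z z₁ z₂ → Deg3 x → Deg3 y → Deg3 z →
         Adj x y → Adj y z → x ≢ z →
         Adj z z₁ → Adj z z₂ → z₁ ≢ z₂ → z₁ ≢ y → z₂ ≢ y →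
         2 ≤ deg z₁ → 2 ≤ deg z₂ →
         Support2 z₁ ⊎ Support2 z₂

  record Good : Set where
    field
      bip  : Bipartite
      maxd : MaxDeg≤3
      g1   : G1
      g2   : G2
      g3   : G3
      g4   : G4

_─ᵍ_ : ∀ {n} → Graph n → Subset n → Graph n
G ─ᵍ X = record { V = V G ─ X ; E = E G ; E-sym = E-sym G ; E-irr = E-irr G }

module Submission where

-- G - X has the adjacency relation of G on fewer vertices, so its
-- adjacencies, neighbourhoods and degrees are bounded by those of G.  Call
-- a vertex of G - X intact if its degree did not drop, i.e. it kept every
-- neighbour it had in G.  Since G has maximum degree three, a vertex of
-- degree three in G - X has degree three in G and is intact.  A leaf of G
-- that survives next to some vertex is a leaf of G - X, an intact vertex
-- keeps its supporting leaf, and a degree-two support vertex of G that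
-- still has degree two in G - X stays one.  With these facts
-- bipartiteness, the degree bound, (G1), (G2) and (G4) pass directly from
-- G to G - X.  (G3) needs more care, because a support vertex of G - X need
-- not be one of G: applying (G2) of G to the edge xy and counting the
-- neighbours of y shows that either x is a support vertex of G or the
-- vertex w in question is already a leaf of G - X.  Doing this for x and
-- for z either concludes or lets us apply (G3) of G, where (G1) of G
-- forces deg y' = 2.  All counting rests on one fact: pairwise distinct
-- members of a finite set are at most as many as its cardinality.

open import Defs
open import Function using (_∘_)
open import Data.Nat using (ℕ; suc; _≤_; s≤s; z≤n; _≟_)
open import Data.Nat.Properties using (≤-trans; ≤-antisym; <-irrefl; ≤∧≢⇒<)
open import Data.Fin using (Fin)
import Data.Fin.Properties as Fin
open import Data.Fin.Subset using (Subset; _⊆_; _∈_; _-_; ∣_∣)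
open import Data.Fin.Subset.Properties
  using (_∈?_; x∈p∩q⁺; x∈p∩q⁻; p─q⊆p; p⊆q⇒∣p∣≤∣q∣; p⊂q⇒∣p∣<∣q∣;
         x∈p∧x≢y⇒x∈p-y; x∈p⇒∣p-x∣<∣p∣)
open import Data.Vec using (tabulate)
open import Data.Vec.Properties using ([]=⇒lookup; lookup⇒[]=; lookup∘tabulate)
open import Data.List using (List; []; _∷_; length)
open import Data.List.Relation.Unary.All as All using (All; []; _∷_)
open import Data.List.Relation.Unary.AllPairs using ([]; _∷_)
open import Data.List.Relation.Unary.Unique.Propositional using (Unique)
open import Data.Product using (∃; _×_; _,_; proj₁; proj₂)
open import Data.Sum using (_⊎_; inj₁; inj₂)
open import Data.Empty using (⊥; ⊥-elim)
open import Relation.Nullary using (¬_; yes; no)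
open import Relation.Binary.PropositionalEquality
  using (_≡_; _≢_; refl; sym; trans; subst; subst₂)

distinct-members≤∣_∣ : ∀ {n} (p : Subset n) {xs : List (Fin n)} →
                        All (_∈ p) xs → Unique xs → length xs ≤ ∣ p ∣
distinct-members≤∣ p ∣ [] [] = z≤n
distinct-members≤∣ p ∣ {x ∷ xs} (x∈p ∷ xs⊆p) (x∉xs ∷ xs-unique) =
  ≤-trans (s≤s (distinct-members≤∣ p - x ∣ xs⊆p-x xs-unique)) (x∈p⇒∣p-x∣<∣p∣ x∈p)
  where
  xs⊆p-x : All (_∈ p - x) xs
  xs⊆p-x = All.zipWith (λ (y∈p , x≢y) → x∈p∧x≢y⇒x∈p-y y∈p (x≢y ∘ sym)) (xs⊆p , x∉xs)

different-degrees : ∀ {n} (G : Graph n) {x y : Fin n} {a b : ℕ} →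
                    deg G x ≡ a → deg G y ≡ b → a ≢ b → x ≢ y
different-degrees G dx dy a≢b refl = a≢b (trans (sym dx) dy)

module _ {n : ℕ} (G : Graph n) where

  adj⇒∈N : ∀ {x y} → Adj G x y → y ∈ N G x
  adj⇒∈N {x} {y} (_ , y∈V , exy) =
    x∈p∩q⁺ (y∈V , lookup⇒[]= y (tabulate (E G x)) (trans (lookup∘tabulate (E G x) y) exy))

  ∈N⇒adj : ∀ {x y} → x ∈ V G → y ∈ N G x → Adj G x y
  ∈N⇒adj {x} {y} x∈V y∈N with x∈p∩q⁻ (V G) (tabulate (E G x)) y∈N
  ... | y∈V , exy = x∈V , y∈V , trans (sym (lookup∘tabulate (E G x) y)) ([]=⇒lookup exy)

  adj-sym : ∀ {x y} → Adj G x y → Adj G y x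
  adj-sym {x} {y} (x∈V , y∈V , exy) = y∈V , x∈V , trans (E-sym G y x) exy

  neighbours≤deg : ∀ {x xs} → All (Adj G x) xs → Unique xs → length xs ≤ deg G x
  neighbours≤deg adj = distinct-members≤∣ _ ∣ (All.map adj⇒∈N adj)

  no-extra-neighbour : ∀ {x k xs} → deg G x ≡ k → All (Adj G x) xs → Unique xs →
                       length xs ≡ suc k → ⊥
  no-extra-neighbour dx adj unique len =
    <-irrefl refl (subst₂ _≤_ len dx (neighbours≤deg adj unique))

  adj⇒deg≥1 : ∀ {x y} → Adj G x y → 1 ≤ deg G y
  adj⇒deg≥1 xy = neighbours≤deg (adj-sym xy ∷ []) ([] ∷ [])

module Deletion {n : ℕ} (G : Graph n) (X : Subset n) where

  G' : Graph n
  G' = G ─ᵍ X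

  V↓ : ∀ {x} → x ∈ V G' → x ∈ V G
  V↓ = p─q⊆p (V G) X

  adj↓ : ∀ {x y} → Adj G' x y → Adj G x y
  adj↓ (x∈V , y∈V , exy) = V↓ x∈V , V↓ y∈V , exy

  N↓ : ∀ {x} → N G' x ⊆ N G x
  N↓ {x} y∈N with x∈p∩q⁻ (V G') (tabulate (E G x)) y∈N
  ... | y∈V , exy = x∈p∩q⁺ (V↓ y∈V , exy)

  deg↓ : ∀ x → deg G' x ≤ deg G x
  deg↓ x = p⊆q⇒∣p∣≤∣q∣ N↓

  Intact : Fin n → Set
  Intact x = x ∈ V G' × deg G' x ≡ deg G x

  -- An intact vertex keeps every neighbour: a missing one would make
  -- N G' x a proper subset of N G x, hence smaller.
  intact-adj : ∀ {x y} → Intact x → Adj G x y → Adj G' x y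
  intact-adj {x} {y} (x∈V , same-deg) xy = ∈N⇒adj G' x∈V y∈N'
    where
    y∈N = adj⇒∈N G xy
    y∈N' : y ∈ N G' x
    y∈N' with y ∈? N G' x
    ... | yes y∈N' = y∈N'
    ... | no y∉N' = ⊥-elim (<-irrefl same-deg (p⊂q⇒∣p∣<∣q∣ (N↓ , y , y∈N , y∉N')))

  leaf↑ : ∀ {v w} → Adj G' v w → Leaf G w → Leaf G' w
  leaf↑ {w = w} vw (_ , dw) =
    proj₁ (proj₂ vw) , ≤-antisym (subst (deg G' w ≤_) dw (deg↓ w)) (adj⇒deg≥1 G' vw)

  intact-support : ∀ {x} → Intact x → Support G x → Support G' x
  intact-support x-intact (l , xl , leaf) = l , xl' , leaf↑ xl' leaf
    where xl' = intact-adj x-intact xl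

  -- A degree-two support vertex of G still of degree at least two in G - X
  -- is intact, so it is a degree-two support vertex of G - X.
  support2↑ : ∀ {v u} → Adj G' v u → 2 ≤ deg G' u → Support2 G u → Support2 G' u
  support2↑ {u = u} vu two≤deg (du , u-support) =
    dG'u , intact-support (proj₁ (proj₂ vu) , trans dG'u (sym du)) u-support
    where
    dG'u : deg G' u ≡ 2
    dG'u = ≤-antisym (subst (deg G' u ≤_) du (deg↓ u)) two≤deg

  -- An intact vertex next to a degree-two support vertex a of G is, in
  -- G - X, next to a degree-two support vertex, or next to the leaf a.
  support2-neighbour↑ : ∀ {x a} → Intact x → Adj G x a → Support2 G a →
                        Support G' x ⊎ (∃ λ a → Adj G' x a × Support2 G' a)
  support2-neighbour↑ {a = a} x-intact xa a-support2 with deg G' a ≟ 1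
  ... | yes da = inj₁ (a , xa' , proj₁ (proj₂ xa') , da)
    where xa' = intact-adj x-intact xa
  ... | no da≢1 =
    inj₂ (a , xa' , support2↑ xa' (≤∧≢⇒< (adj⇒deg≥1 G' xa') (da≢1 ∘ sym)) a-support2)
    where xa' = intact-adj x-intact xa

  module _ (maxdeg : MaxDeg≤3 G) where

    deg3↓ : ∀ {x} → Deg3 G' x → Deg3 G x
    deg3↓ {x} (x∈V , dx) =
      V↓ x∈V , ≤-antisym (maxdeg x (V↓ x∈V)) (subst (_≤ deg G x) dx (deg↓ x))

    deg3-intact : ∀ {x} → Deg3 G' x → Intact x
    deg3-intact x3@(x∈V , dx) = x∈V , trans dx (sym (proj₂ (deg3↓ x3)))

module Heredity {n : ℕ} (G : Graph n) (X : Subset n) (good : Good G) where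
  open Good good
  open Deletion G X

  bipartite' : Bipartite G'
  bipartite' = proj₁ bip , λ x y xy → proj₂ bip x y (adj↓ xy)

  maxdeg' : MaxDeg≤3 G'
  maxdeg' x x∈V = ≤-trans (deg↓ x) (maxd x (V↓ x∈V))

  g1' : G1 G'
  g1' x x3 (a , b , c , a≢b , a≢c , b≢c , xa , xb , xc , a3 , b3 , c3) =
    g1 x (deg3↓ maxd x3) (a , b , c , a≢b , a≢c , b≢c , adj↓ xa , adj↓ xb , adj↓ xc ,
                           deg3↓ maxd a3 , deg3↓ maxd b3 , deg3↓ maxd c3)

  g2' : G2 G'
  g2' x y x3 y3 xy with g2 x y (deg3↓ maxd x3) (deg3↓ maxd y3) (adj↓ xy)
  ... | inj₁ (inj₁ x-support) = inj₁ (inj₁ (intact-support (deg3-intact maxd x3) x-support))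
  ... | inj₁ (inj₂ y-support) = inj₁ (inj₂ (intact-support (deg3-intact maxd y3) y-support))
  ... | inj₂ ((a , xa , a-support2) , (b , yb , b-support2))
    with support2-neighbour↑ (deg3-intact maxd x3) xa a-support2
       | support2-neighbour↑ (deg3-intact maxd y3) yb b-support2
  ... | inj₁ x-support | _ = inj₁ (inj₁ x-support)
  ... | inj₂ _ | inj₁ y-support = inj₁ (inj₂ y-support)
  ... | inj₂ x-side | inj₂ y-side = inj₂ (x-side , y-side)

  g4' : G4 G'
  g4' x y z z₁ z₂ x3 y3 z3 xy yz x≢z zz₁ zz₂ z₁≢z₂ z₁≢y z₂≢y two≤z₁ two≤z₂
    with g4 x y z z₁ z₂ (deg3↓ maxd x3) (deg3↓ maxd y3) (deg3↓ maxd z3)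
            (adj↓ xy) (adj↓ yz) x≢z (adj↓ zz₁) (adj↓ zz₂) z₁≢z₂ z₁≢y z₂≢y
            (≤-trans two≤z₁ (deg↓ z₁)) (≤-trans two≤z₂ (deg↓ z₂))
  ... | inj₁ z₁-support2 = inj₁ (support2↑ zz₁ two≤z₁ z₁-support2)
  ... | inj₂ z₂-support2 = inj₂ (support2↑ zz₂ two≤z₂ z₂-support2)

  module G3-configuration
    {x y z y' : Fin n} (x3 : Deg3 G' x) (y3 : Deg3 G' y) (z3 : Deg3 G' z)
    (xy : Adj G' x y) (yz : Adj G' y z) (x≢z : x ≢ z)
    (yy' : Adj G' y y') (y'≢x : y' ≢ x) (y'≢z : y' ≢ z) (dy' : deg G' y' ≡ 2)
    where

    ≢-deg3 : ∀ {v u k} → Deg3 G' u → deg G v ≡ k → 3 ≢ k → v ≢ u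
    ≢-deg3 u3 dv 3≢k = different-degrees G dv (proj₂ (deg3↓ maxd u3)) (3≢k ∘ sym)

    third-neighbour : ∀ {v} → Adj G y v → v ≢ x → v ≢ z → v ≡ y'
    third-neighbour {v} yv v≢x v≢z with v Fin.≟ y'
    ... | yes v≡y' = v≡y'
    ... | no v≢y' = ⊥-elim (no-extra-neighbour G' (proj₂ y3)
          (adj-sym G' xy ∷ yz ∷ yy' ∷ intact-adj (deg3-intact maxd y3) yv ∷ [])
          ((x≢z ∷ (y'≢x ∘ sym) ∷ (v≢x ∘ sym) ∷ []) ∷ ((y'≢z ∘ sym) ∷ (v≢z ∘ sym) ∷ []) ∷
           ((v≢y' ∘ sym) ∷ []) ∷ [] ∷ [])
          refl)

    -- y supports no leaf in G: that leaf would have to be y', of degree two.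
    y-not-support : ¬ Support G y
    y-not-support (l , yl , l-leaf) =
      different-degrees G' (proj₂ (leaf↑ yl' l-leaf)) dy' (λ ())
        (third-neighbour yl (≢-deg3 x3 (proj₂ l-leaf) λ ()) (≢-deg3 z3 (proj₂ l-leaf) λ ()))
      where yl' = intact-adj (deg3-intact maxd y3) yl

    -- If y' is a degree-two support vertex of G, then it is intact and its
    -- neighbour other than y is its leaf, which stays a leaf.
    beyond-support2 : Support2 G y' → ∀ {w} → Adj G' y' w → w ≢ y → Leaf G' w
    beyond-support2 (dGy' , l , y'l , l-leaf) {w} y'w w≢y with w Fin.≟ l
    ... | yes refl = leaf↑ y'w l-leaf
    ... | no w≢l = ⊥-elim (no-extra-neighbour G' dy'
          (adj-sym G' yy' ∷ y'w ∷ intact-adj y'-intact y'l ∷ [])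
          (((w≢y ∘ sym) ∷ (l≢y ∘ sym) ∷ []) ∷ (w≢l ∷ []) ∷ [] ∷ [])
          refl)
      where
      y'-intact : Intact y'
      y'-intact = proj₁ (proj₂ yy') , trans dy' (sym dGy')
      l≢y = ≢-deg3 y3 (proj₂ l-leaf) λ ()

    -- (G2) of G on the edge xy: x is a support vertex of G, or every
    -- neighbour of y' other than y is a leaf of G - X.
    x-support-or-leaf : ∀ {w} → Adj G' y' w → w ≢ y → Support G x ⊎ Leaf G' w
    x-support-or-leaf y'w w≢y
      with g2 x y (deg3↓ maxd x3) (deg3↓ maxd y3) (adj↓ xy)
    ... | inj₁ (inj₁ x-support) = inj₁ x-support
    ... | inj₁ (inj₂ y-support) = ⊥-elim (y-not-support y-support)
    ... | inj₂ (_ , (b , yb , b-support2))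
      with third-neighbour yb (≢-deg3 x3 (proj₁ b-support2) λ ())
                              (≢-deg3 z3 (proj₁ b-support2) λ ())
    ...   | refl = inj₂ (beyond-support2 b-support2 y'w w≢y)

    -- deg y' = 2 also in G, since otherwise y would contradict (G1) of G.
    y'-deg2 : deg G y' ≡ 2
    y'-deg2 with deg G y' ≟ 2
    ... | yes d = d
    ... | no d≢2 = ⊥-elim (g1 y (deg3↓ maxd y3)
          (x , z , y' , x≢z , y'≢x ∘ sym , y'≢z ∘ sym ,
           adj-sym G (adj↓ xy) , adj↓ yz , adj↓ yy' ,
           deg3↓ maxd x3 , deg3↓ maxd z3 , y'∈V , ≤-antisym (maxd y' y'∈V) three≤deg))
      where
      y'∈V = V↓ (proj₁ (proj₂ yy'))
      three≤deg = ≤∧≢⇒< (subst (_≤ deg G y') dy' (deg↓ y')) (d≢2 ∘ sym)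

  g3' : G3 G'
  g3' x y z y' x3 y3 z3 xy yz x≢z _ _ yy' y'≢x y'≢z dy' w y'w w≢y =
    combine (x-side.x-support-or-leaf y'w w≢y) (z-side.x-support-or-leaf y'w w≢y)
    where
    module x-side = G3-configuration x3 y3 z3 xy yz x≢z yy' y'≢x y'≢z dy'
    module z-side = G3-configuration z3 y3 x3 (adj-sym G' yz) (adj-sym G' xy)
                      (x≢z ∘ sym) yy' y'≢z y'≢x dy'
    combine : Support G x ⊎ Leaf G' w → Support G z ⊎ Leaf G' w → Leaf G' w
    combine (inj₂ w-leaf) _ = w-leaf
    combine (inj₁ _) (inj₂ w-leaf) = w-leaf
    combine (inj₁ x-support) (inj₁ z-support) =
      leaf↑ y'w (g3 x y z y' (deg3↓ maxd x3) (deg3↓ maxd y3) (deg3↓ maxd z3)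
                   (adj↓ xy) (adj↓ yz) x≢z x-support z-support (adj↓ yy') y'≢x y'≢z
                   x-side.y'-deg2 w (adj↓ y'w) w≢y)

  good' : Good G'
  good' = record { bip = bipartite' ; maxd = maxdeg' ; g1 = g1' ; g2 = g2' ; g3 = g3' ; g4 = g4' }

lemma22 : ∀ {n : ℕ} (G : Graph n) (X : Subset n) → X ⊆ V G → Good G → Good (G ─ᵍ X)
lemma22 G X _ good = Heredity.good' G X good
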